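{- Let $A_{n,k}(q)$ denote the $q$-Eulerian numbers defined below. For any positive integers $a$ and $b$, $$\sum_{k\geq 0}{\begin{bmatrix} a+b\\ k\end{bmatrix}}_q A_{k,a-1}(q)=\sum_{k\geq 0}{\begin{bmatrix} a+b\\ k\end{bmatrix}}_q A_{k,b-1}(q).$$
   Context: For a positive integer $n$ let $(z;q)_n=\prod_{i=0}^{n-1}(1-zq^i)$, and $(z;q)_0=1$. The $q$-exponential function is $e(z;q)=\sum_{n\geq 0} z^n/(q;q)_n$. The $q$-Eulerian polynomials $A_n(t,q)$ are defined by the generating function $$\sum_{n\geq 0}A_n(t,q)\frac{z^n}{(q;q)_n}=\frac{e(z;q)-e(tz;q)}{e(tz;q)-t\,e(z;q)}$$ (so in particular $A_0(t,q)=0$), and the $q$-Eulerian numbers $A_{n,k}(q)$ are their coefficients: $A_n(t,q)=\sum_{k=0}^n A_{n,k}(q)t^k$, with $A_{n,k}(q)=0$ for $k<0$ or $k>n$. The $q$-binomial coefficient is ${\begin{bmatrix} n\\ k\end{bmatrix}}_q=\frac{(q;q)_n}{(q;q)_{n-k}(q;q)_k}$ for $0\le k\le n$ and $0$ if $k<0$ or $k>n$. -}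

module Defs where

open import Data.Nat using (ℕ; zero; suc; _∸_; _≤ᵇ_; _≡ᵇ_) renaming (_+_ to _+ℕ_)
open import Data.Integer using (ℤ; 0ℤ; 1ℤ; _+_; _*_; -_; _-_)
open import Data.Bool using (if_then_else_)

-- Formal power series are represented by their coefficient functions.
-- S1 : power series in q with integer coefficients (coefficient of q^j).
-- S3 : power series in z, t, q with integer coefficients
--      (S3 f n i j = coefficient of z^n t^i q^j).
S1 : Set
S1 = ℕ → ℤ

S3 : Set
S3 = ℕ → ℕ → ℕ → ℤ

sumTo : ℕ → (ℕ → ℤ) → ℤ
sumTo zero    f = f 0
sumTo (suc n) f = sumTo n f + f (suc n)

zero1 : S1
zero1 _ = 0ℤ

one1 : S1
one1 j = if j ≡ᵇ 0 then 1ℤ else 0ℤ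

mono1 : ℕ → S1
mono1 i j = if j ≡ᵇ i then 1ℤ else 0ℤ

sub1 : S1 → S1 → S1
sub1 f g j = f j - g j

mul1 : S1 → S1 → S1
mul1 f g n = sumTo n (λ i → f i * g (n ∸ i))

pow1 : S1 → ℕ → S1
pow1 f zero    = one1
pow1 f (suc m) = mul1 (pow1 f m) f

-- multiplicative inverse of a series with constant term 1:
-- 1/f = Σ_m (1 - f)^m, and (1-f)^m only contributes to degrees ≥ m.
inv1 : S1 → S1
inv1 f n = sumTo n (λ m → pow1 (sub1 one1 f) m n)

qq : ℕ → S1
qq zero    = one1
qq (suc n) = mul1 (qq n) (sub1 one1 (mono1 (suc n)))

qbinom : ℕ → ℕ → S1
qbinom n k = if k ≤ᵇ n then mul1 (qq n) (mul1 (inv1 (qq (n ∸ k))) (inv1 (qq k))) else zero1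

one3 : S3
one3 n i j = if n ≡ᵇ 0 then (if i ≡ᵇ 0 then (if j ≡ᵇ 0 then 1ℤ else 0ℤ) else 0ℤ) else 0ℤ

sub3 : S3 → S3 → S3
sub3 f g n i j = f n i j - g n i j

mul3 : S3 → S3 → S3
mul3 f g a b c =
  sumTo a (λ n → sumTo b (λ i → sumTo c (λ j →
    f n i j * g (a ∸ n) (b ∸ i) (c ∸ j))))

pow3 : S3 → ℕ → S3
pow3 f zero    = one3
pow3 f (suc m) = mul3 (pow3 f m) f

inv3 : S3 → S3
inv3 f a b c = sumTo (a +ℕ b +ℕ c) (λ m → pow3 (sub3 one3 f) m a b c)

-- e(z;q) = Σ_n z^n / (q;q)_n
eZ : S3
eZ n i j = if i ≡ᵇ 0 then inv1 (qq n) j else 0ℤ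

-- e(tz;q) = Σ_n t^n z^n / (q;q)_n
eTZ : S3
eTZ n i j = if i ≡ᵇ n then inv1 (qq n) j else 0ℤ

tEZ : S3
tEZ n i j = if i ≡ᵇ 1 then inv1 (qq n) j else 0ℤ

-- generating function (e(z;q) - e(tz;q)) / (e(tz;q) - t e(z;q))
--   = Σ_n A_n(t,q) z^n / (q;q)_n
genA : S3
genA = mul3 (sub3 eZ eTZ) (inv3 (sub3 eTZ tEZ))

-- q-Eulerian number A_{n,k}(q) = coefficient of t^k in A_n(t,q),
-- i.e. (q;q)_n times the coefficient of z^n t^k in genA.
qEuler : ℕ → ℕ → S1
qEuler n k = mul1 (qq n) (λ j → genA n k j)

sumS : ℕ → (ℕ → S1) → S1
sumS N f j = sumTo N (λ k → f k j)

-- The q-Eulerian polynomials are read off from G = (e(z) − e(tz)) / (e(tz) − t e(z)), where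
-- e(z) = Σ E_n z^n with E_n = 1/(q;q)_n.  Numerator and denominator are both divisible by 1 − t,
-- G = num₁/den₁ with num₁ = Σ E_n (1 + t + ⋯ + t^(n−1)) z^n and den₁ = Σ E_n (1 − (1 + t + ⋯ + t^(n−1))) z^n.
-- So the z^n-coefficient G_n has t-degree below n, and the substitution F(z,t) ↦ F(tz, 1/t) multiplies
-- num₁ by t and fixes den₁; hence t^n G_n(1/t) = t G_n(t).
-- Put N = a + b and Y = G e(z).  The coefficient of z^N t^a in G (e(tz) − t e(z)) = e(z) − e(tz)
-- gives [z^N t^a] G e(tz) = [z^N t^(a−1)] Y, and by the palindromicity [z^N t^a] G e(tz) = [z^N t^(b−1)] Y.
-- Finally Σ_k [N k]_q A_{k,c} = (q;q)_N [z^N t^c] Y, because A_{k,c} = (q;q)_k [z^k t^c] G.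

module Submission where

open import Algebra.Bundles using (CommutativeRing)
open import Level using (_⊔_) renaming (suc to lsuc)
import Algebra.Construct.Pointwise as Pointwise
import Algebra.Properties.Ring as RingProperties
import Algebra.Properties.CommutativeSemigroup as CommutativeSemigroupProperties
open import Data.Nat as ℕ using (ℕ; zero; suc; _∸_; _≤_; _<_; z≤n; s≤s)
import Data.Nat.Properties as ℕₚ
open import Data.Product using (_,_)
open import Data.Sum using (inj₁; inj₂)
open import Relation.Nullary using (yes; no; contradiction)
open import Function using (_∘_)
open import Relation.Binary.PropositionalEquality as ≡ using (_≡_; _≢_)
import Relation.Binary.Reasoning.Setoid as SetoidReasoning
open import Data.Bool using (true; if_then_else_)
open import Data.Integer as ℤ using (0ℤ; 1ℤ)
import Data.Integer.Properties as ℤₚ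
open import Defs

∸-+-≤ : ∀ m k i j → (m ℕ.+ k) ∸ (i ℕ.+ j) ≤ (m ∸ i) ℕ.+ (k ∸ j)
∸-+-≤ m k i j = ℕₚ.m≤n+o⇒m∸n≤o (m ℕ.+ k) (i ℕ.+ j) (begin
  m ℕ.+ k                                ≤⟨ ℕₚ.+-mono-≤ (ℕₚ.m≤n+m∸n m i) (ℕₚ.m≤n+m∸n k j) ⟩
  (i ℕ.+ (m ∸ i)) ℕ.+ (j ℕ.+ (k ∸ j))    ≡⟨ +-interchange i (m ∸ i) j (k ∸ j) ⟩
  (i ℕ.+ j) ℕ.+ ((m ∸ i) ℕ.+ (k ∸ j))    ∎)
  where
  open ℕₚ.≤-Reasoning
  open CommutativeSemigroupProperties ℕₚ.+-commutativeSemigroup using () renaming (interchange to +-interchange)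

≤∧+<⇒<∸ : ∀ {a b i j} → j ≤ a → a ℕ.+ b < i → b < i ∸ j
≤∧+<⇒<∸ {a} {b} {i} {j} j≤a a+b<i = ℕₚ.m+n≤o⇒m≤o∸n (suc b) (begin
  suc b ℕ.+ j      ≤⟨ ℕₚ.+-monoʳ-≤ (suc b) j≤a ⟩
  suc b ℕ.+ a      ≡⟨ ≡.cong suc (ℕₚ.+-comm b a) ⟩
  suc (a ℕ.+ b)    ≤⟨ a+b<i ⟩
  i                ∎)
  where open ℕₚ.≤-Reasoning

0<m∸n⇒n<m : ∀ {m n} → 0 < m ∸ n → n < m
0<m∸n⇒n<m 0<m∸n = ℕₚ.m∸n≢0⇒n<m (ℕₚ.>⇒≢ 0<m∸n)

∸-∸-∸ : ∀ m a b c → ((m ∸ a) ∸ b) ∸ c ≡ m ∸ (a ℕ.+ b ℕ.+ c)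
∸-∸-∸ m a b c = ≡.trans (≡.cong (_∸ c) (ℕₚ.∸-+-assoc m a b)) (ℕₚ.∸-+-assoc m (a ℕ.+ b) c)

<-+-∸ : ∀ a {b m} → m ≤ b → a < (a ℕ.+ suc b) ∸ m
<-+-∸ a {b} {m} m≤b = ≡.subst (a <_) (≡.sym (ℕₚ.+-∸-assoc a (ℕₚ.m≤n⇒m≤1+n m≤b)))
                             (ℕₚ.m<m+n a (ℕₚ.m<n⇒0<n∸m (s≤s m≤b)))

+-∸-≤ : ∀ a {b m} → b < m → m ≤ a ℕ.+ suc b → (a ℕ.+ suc b) ∸ m ≤ a
+-∸-≤ a {b} {m} b<m m≤N = ℕₚ.m≤n+o⇒m∸n≤o (a ℕ.+ suc b) m
                             (≡.subst (a ℕ.+ suc b ≤_) (ℕₚ.+-comm a m) (ℕₚ.+-monoʳ-≤ a b<m))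

∸-+-∸ : ∀ a {b m} → b < m → m ≤ a ℕ.+ suc b → a ∸ ((a ℕ.+ suc b) ∸ m) ≡ m ∸ suc b
∸-+-∸ a {b} {m} b<m m≤N = begin
  a ∸ ((a ℕ.+ suc b) ∸ m)                     ≡⟨ ≡.cong (λ k → a ∸ ((a ℕ.+ suc b) ∸ k)) (ℕₚ.m+[n∸m]≡n b<m) ⟨
  a ∸ ((a ℕ.+ suc b) ∸ (suc b ℕ.+ d))         ≡⟨ ≡.cong (λ k → a ∸ (k ∸ (suc b ℕ.+ d))) (ℕₚ.+-comm a (suc b)) ⟩
  a ∸ ((suc b ℕ.+ a) ∸ (suc b ℕ.+ d))         ≡⟨ ≡.cong (a ∸_) (ℕₚ.[m+n]∸[m+o]≡n∸o (suc b) a d) ⟩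
  a ∸ (a ∸ d)                                 ≡⟨ ℕₚ.m∸[m∸n]≡n d≤a ⟩
  d                                           ∎
  where
  open ≡.≡-Reasoning
  d = m ∸ suc b
  d≤a : d ≤ a
  d≤a = ℕₚ.m≤n+o⇒m∸n≤o m (suc b) (≡.subst (m ≤_) (ℕₚ.+-comm a (suc b)) m≤N)

module RingLemmas {c ℓ} (R : CommutativeRing c ℓ) where
  open CommutativeRing R
  open RingProperties ring using (⁻¹-anti-homo‿-)
  open CommutativeSemigroupProperties +-commutativeSemigroup using () renaming (interchange to +-interchange)
  open SetoidReasoning setoid

  x+y≈z+w⇒z-y≈x-w : ∀ {x y z w} → x + y ≈ z + w → z - y ≈ x - w
  x+y≈z+w⇒z-y≈x-w {x} {y} {z} {w} eq = begin
    z - y                  ≈⟨ +-identityʳ _ ⟨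
    (z - y) + 0#           ≈⟨ +-congˡ (-‿inverseʳ w) ⟨
    (z - y) + (w - w)      ≈⟨ +-interchange z (- y) w (- w) ⟩
    (z + w) + (- y - w)    ≈⟨ +-cong (sym eq) (+-comm _ _) ⟩
    (x + y) + (- w - y)    ≈⟨ +-interchange x y (- w) (- y) ⟩
    (x - w) + (y - y)      ≈⟨ +-congˡ (-‿inverseʳ y) ⟩
    (x - w) + 0#           ≈⟨ +-identityʳ _ ⟩
    x - w                  ∎

  [x-y]-[x-z]≈z-y : ∀ x y z → (x - y) - (x - z) ≈ z - y
  [x-y]-[x-z]≈z-y x y z = begin
    (x - y) - (x - z)      ≈⟨ +-congˡ (⁻¹-anti-homo‿- x z) ⟩
    (x - y) + (z - x)      ≈⟨ +-comm _ _ ⟩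
    (z - x) + (x - y)      ≈⟨ +-assoc _ _ _ ⟩
    z + (- x + (x - y))    ≈⟨ +-congˡ (+-assoc _ _ _) ⟨
    z + ((- x + x) - y)    ≈⟨ +-congˡ (+-congʳ (-‿inverseˡ x)) ⟩
    z + (0# - y)           ≈⟨ +-congˡ (+-identityˡ _) ⟩
    z - y                  ∎

  [x*[y*z]]*[w*v]≈x*[y*v] : ∀ x y z w v → z * w ≈ 1# → (x * (y * z)) * (w * v) ≈ x * (y * v)
  [x*[y*z]]*[w*v]≈x*[y*v] x y z w v zw≈1 = begin
    (x * (y * z)) * (w * v)   ≈⟨ *-assoc x (y * z) (w * v) ⟩
    x * ((y * z) * (w * v))   ≈⟨ *-congˡ (*-assoc y z (w * v)) ⟩
    x * (y * (z * (w * v)))   ≈⟨ *-congˡ (*-congˡ (*-assoc z w v)) ⟨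
    x * (y * ((z * w) * v))   ≈⟨ *-congˡ (*-congˡ (trans (*-congʳ zw≈1) (*-identityˡ v))) ⟩
    x * (y * v)               ∎

  *-cancelʳ-invertible : ∀ {x y d d⁻¹} → d⁻¹ * d ≈ 1# → x * d ≈ y * d → x ≈ y
  *-cancelʳ-invertible {x} {y} {d} {d⁻¹} d⁻¹d≈1 xd≈yd = begin
    x                ≈⟨ *-identityʳ x ⟨
    x * 1#           ≈⟨ *-congˡ dd⁻¹≈1 ⟨
    x * (d * d⁻¹)    ≈⟨ *-assoc _ _ _ ⟨
    (x * d) * d⁻¹    ≈⟨ *-congʳ xd≈yd ⟩
    (y * d) * d⁻¹    ≈⟨ *-assoc _ _ _ ⟩
    y * (d * d⁻¹)    ≈⟨ *-congˡ dd⁻¹≈1 ⟩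
    y * 1#           ≈⟨ *-identityʳ y ⟩
    y                ∎
    where dd⁻¹≈1 = trans (*-comm d d⁻¹) d⁻¹d≈1

module RingSums {c ℓ} (R : CommutativeRing c ℓ) where
  open CommutativeRing R
  open RingProperties ring using (-‿distribʳ-*)
  open CommutativeSemigroupProperties +-commutativeSemigroup using () renaming (interchange to +-interchange)
  open SetoidReasoning setoid

  ∑ : ℕ → (ℕ → Carrier) → Carrier
  ∑ zero    f = f 0
  ∑ (suc n) f = ∑ n f + f (suc n)

  ∑-cong≤ : ∀ n {f g} → (∀ i → i ≤ n → f i ≈ g i) → ∑ n f ≈ ∑ n g
  ∑-cong≤ zero    f≈g = f≈g 0 z≤n
  ∑-cong≤ (suc n) f≈g = +-cong (∑-cong≤ n (λ i i≤n → f≈g i (ℕₚ.m≤n⇒m≤1+n i≤n))) (f≈g (suc n) ℕₚ.≤-refl)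

  ∑-cong : ∀ n {f g} → (∀ i → f i ≈ g i) → ∑ n f ≈ ∑ n g
  ∑-cong n f≈g = ∑-cong≤ n (λ i _ → f≈g i)

  ∑-zero : ∀ n {f} → (∀ i → i ≤ n → f i ≈ 0#) → ∑ n f ≈ 0#
  ∑-zero n {f} f≈0 = trans (∑-cong≤ n f≈0) (∑-const0 n)
    where
    ∑-const0 : ∀ n → ∑ n (λ _ → 0#) ≈ 0#
    ∑-const0 zero    = refl
    ∑-const0 (suc n) = trans (+-identityʳ _) (∑-const0 n)

  ∑-+ : ∀ n f g → ∑ n (λ i → f i + g i) ≈ ∑ n f + ∑ n g
  ∑-+ zero    f g = refl
  ∑-+ (suc n) f g = trans (+-congʳ (∑-+ n f g)) (+-interchange _ _ _ _)

  *-distribˡ-∑ : ∀ n x f → x * ∑ n f ≈ ∑ n (λ i → x * f i)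
  *-distribˡ-∑ zero    x f = refl
  *-distribˡ-∑ (suc n) x f = trans (distribˡ x _ _) (+-congʳ (*-distribˡ-∑ n x f))

  ∑-unfoldˡ : ∀ n f → ∑ (suc n) f ≈ f 0 + ∑ n (f ∘ suc)
  ∑-unfoldˡ zero    f = refl
  ∑-unfoldˡ (suc n) f = trans (+-congʳ (∑-unfoldˡ n f)) (+-assoc _ _ _)

  ∑-reverse : ∀ n f → ∑ n f ≈ ∑ n (λ i → f (n ∸ i))
  ∑-reverse zero    f = refl
  ∑-reverse (suc n) f = begin
    ∑ n f + f (suc n)                  ≈⟨ +-comm _ _ ⟩
    f (suc n) + ∑ n f                  ≈⟨ +-congˡ (∑-reverse n f) ⟩
    f (suc n) + ∑ n (λ i → f (n ∸ i))  ≈⟨ ∑-unfoldˡ n _ ⟨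
    ∑ (suc n) (λ i → f (suc n ∸ i))    ∎

  ∑-truncate : ∀ {n} M {f} → n ≤ M → (∀ i → n < i → i ≤ M → f i ≈ 0#) → ∑ M f ≈ ∑ n f
  ∑-truncate zero    z≤n _ = refl
  ∑-truncate (suc M) n≤1+M f≈0 with ℕₚ.m≤n⇒m<n∨m≡n n≤1+M
  ... | inj₂ ≡.refl = refl
  ... | inj₁ n<1+M  = trans (+-cong (∑-truncate M (ℕₚ.≤-pred n<1+M) (λ i n<i i≤M → f≈0 i n<i (ℕₚ.m≤n⇒m≤1+n i≤M)))
                                    (f≈0 (suc M) n<1+M ℕₚ.≤-refl))
                            (+-identityʳ _)

  infixr 8 _^_
  _^_ : Carrier → ℕ → Carrier
  x ^ zero  = 1#
  x ^ suc m = x ^ m * x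

  ^-cong : ∀ {x y} m → x ≈ y → x ^ m ≈ y ^ m
  ^-cong zero    x≈y = refl
  ^-cong (suc m) x≈y = *-cong (^-cong m x≈y) x≈y

  geometric-sum : ∀ M h → ∑ M (h ^_) * (1# - h) ≈ 1# - h ^ suc M
  geometric-sum zero h = begin
    1# * (1# - h)       ≈⟨ *-identityˡ _ ⟩
    1# - h              ≈⟨ +-congˡ (-‿cong (*-identityˡ h)) ⟨
    1# - 1# * h         ∎
  geometric-sum (suc M) h = begin
    (∑ M (h ^_) + h ^ suc M) * (1# - h)                   ≈⟨ distribʳ _ _ _ ⟩
    ∑ M (h ^_) * (1# - h) + h ^ suc M * (1# - h)          ≈⟨ +-cong (geometric-sum M h) (distribˡ _ _ _) ⟩
    (1# - p) + (p * 1# + p * - h)                         ≈⟨ +-congˡ (+-cong (*-identityʳ p) (sym (-‿distribʳ-* p h))) ⟩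
    (1# - p) + (p - p * h)                                ≈⟨ +-assoc _ _ _ ⟩
    1# + (- p + (p - p * h))                              ≈⟨ +-congˡ (+-assoc _ _ _) ⟨
    1# + ((- p + p) - p * h)                              ≈⟨ +-congˡ (trans (+-congʳ (-‿inverseˡ p)) (+-identityˡ _)) ⟩
    1# - p * h                                            ∎
    where p = h ^ suc M

module PowerSeries {c ℓ} (R : CommutativeRing c ℓ) where
  open CommutativeRing R
  open RingProperties ring using (-‿distribʳ-*)
  open RingSums R public
  open SetoidReasoning setoid

  Series : Set c
  Series = ℕ → Carrier

  infix  4 _≋_
  infixl 6 _⊕_
  infixl 7 _⋆_ _·_
  infix  8 ⊝_

  _≋_ : Series → Series → Set ℓ
  f ≋ g = ∀ n → f n ≈ g n

  _⊕_ : Series → Series → Series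
  (f ⊕ g) n = f n + g n

  ⊝_ : Series → Series
  (⊝ f) n = - f n

  𝟘 : Series
  𝟘 _ = 0#

  𝟙 : Series
  𝟙 zero    = 1#
  𝟙 (suc _) = 0#

  _·_ : Carrier → Series → Series
  (x · f) n = x * f n

  _⋆_ : Series → Series → Series
  (f ⋆ g) n = ∑ n (λ i → f i * g (n ∸ i))

  shift : Series → Series
  shift f zero    = 0#
  shift f (suc n) = f n

  ⋆-cong : ∀ {f f′ g g′} → f ≋ f′ → g ≋ g′ → f ⋆ g ≋ f′ ⋆ g′
  ⋆-cong f≋f′ g≋g′ n = ∑-cong n (λ i → *-cong (f≋f′ i) (g≋g′ (n ∸ i)))

  ⋆-congʳ : ∀ {f f′} g → f ≋ f′ → f ⋆ g ≋ f′ ⋆ g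
  ⋆-congʳ g f≋f′ = ⋆-cong {g = g} {g′ = g} f≋f′ (λ _ → refl)

  ⋆-congˡ : ∀ f {g g′} → g ≋ g′ → f ⋆ g ≋ f ⋆ g′
  ⋆-congˡ f g≋g′ = ⋆-cong {f = f} {f′ = f} (λ _ → refl) g≋g′

  ⋆-unfold : ∀ f g n → (f ⋆ g) (suc n) ≈ f 0 * g (suc n) + (f ∘ suc ⋆ g) n
  ⋆-unfold f g n = ∑-unfoldˡ n _

  ⋆-comm : ∀ f g → f ⋆ g ≋ g ⋆ f
  ⋆-comm f g n = trans (∑-reverse n _) (∑-cong≤ n (λ i i≤n →
    trans (*-comm _ _) (*-congʳ (reflexive (≡.cong g (ℕₚ.m∸[m∸n]≡n i≤n))))))

  ⋆-distribʳ : ∀ f g h → (f ⊕ g) ⋆ h ≋ f ⋆ h ⊕ g ⋆ h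
  ⋆-distribʳ f g h n = trans (∑-cong n (λ i → distribʳ _ _ _)) (∑-+ n _ _)

  ⋆-distribˡ : ∀ f g h → h ⋆ (f ⊕ g) ≋ h ⋆ f ⊕ h ⋆ g
  ⋆-distribˡ f g h n = trans (∑-cong n (λ i → distribˡ _ _ _)) (∑-+ n _ _)

  ·-⋆ : ∀ x f g → x · f ⋆ g ≋ x · (f ⋆ g)
  ·-⋆ x f g n = trans (∑-cong n (λ i → *-assoc x (f i) (g (n ∸ i)))) (sym (*-distribˡ-∑ n x _))

  ⋆-· : ∀ x f g → f ⋆ (x · g) ≋ x · (f ⋆ g)
  ⋆-· x f g n = trans (⋆-comm f (x · g) n) (trans (·-⋆ x g f n) (*-congˡ (⋆-comm g f n)))

  ·-congʳ : ∀ x {f g} → f ≋ g → x · f ≋ x · g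
  ·-congʳ x f≋g n = *-congˡ (f≋g n)

  ·-distrib-⊕ : ∀ x f g → x · (f ⊕ g) ≋ x · f ⊕ x · g
  ·-distrib-⊕ x f g n = distribˡ x (f n) (g n)

  ·-distrib-⊝ : ∀ x f → x · (⊝ f) ≋ ⊝ (x · f)
  ·-distrib-⊝ x f n = sym (-‿distribʳ-* x (f n))

  ⋆-assoc : ∀ f g h → (f ⋆ g) ⋆ h ≋ f ⋆ (g ⋆ h)
  ⋆-assoc f g h zero    = *-assoc _ _ _
  ⋆-assoc f g h (suc n) = begin
    ((f ⋆ g) ⋆ h) (suc n)
      ≈⟨ ⋆-unfold (f ⋆ g) h n ⟩
    (f 0 * g 0) * h (suc n) + ((f ⋆ g) ∘ suc ⋆ h) n
      ≈⟨ +-congˡ (⋆-congʳ h (⋆-unfold f g) n) ⟩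
    (f 0 * g 0) * h (suc n) + ((f 0 · (g ∘ suc) ⊕ (f ∘ suc) ⋆ g) ⋆ h) n
      ≈⟨ +-congˡ (trans (⋆-distribʳ _ _ h n) (+-cong (·-⋆ (f 0) (g ∘ suc) h n) (⋆-assoc (f ∘ suc) g h n))) ⟩
    (f 0 * g 0) * h (suc n) + (f 0 * (g ∘ suc ⋆ h) n + (f ∘ suc ⋆ (g ⋆ h)) n)
      ≈⟨ +-assoc _ _ _ ⟨
    ((f 0 * g 0) * h (suc n) + f 0 * (g ∘ suc ⋆ h) n) + (f ∘ suc ⋆ (g ⋆ h)) n
      ≈⟨ +-congʳ (trans (+-congʳ (*-assoc _ _ _)) (sym (distribˡ _ _ _))) ⟩
    f 0 * (g 0 * h (suc n) + (g ∘ suc ⋆ h) n) + (f ∘ suc ⋆ (g ⋆ h)) n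
      ≈⟨ +-congʳ (*-congˡ (⋆-unfold g h n)) ⟨
    f 0 * (g ⋆ h) (suc n) + (f ∘ suc ⋆ (g ⋆ h)) n
      ≈⟨ ⋆-unfold f (g ⋆ h) n ⟨
    (f ⋆ (g ⋆ h)) (suc n) ∎

  ⋆-zeroˡ : ∀ g → 𝟘 ⋆ g ≋ 𝟘
  ⋆-zeroˡ g n = ∑-zero n (λ i _ → zeroˡ _)

  ⋆-zeroʳ : ∀ g → g ⋆ 𝟘 ≋ 𝟘
  ⋆-zeroʳ g n = trans (⋆-comm g 𝟘 n) (⋆-zeroˡ g n)

  ⋆-identityˡ : ∀ g → 𝟙 ⋆ g ≋ g
  ⋆-identityˡ g zero    = *-identityˡ _
  ⋆-identityˡ g (suc n) = trans (⋆-unfold 𝟙 g n) (trans (+-cong (*-identityˡ _) (⋆-zeroˡ g n)) (+-identityʳ _))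

  ⋆-identityʳ : ∀ g → g ⋆ 𝟙 ≋ g
  ⋆-identityʳ g n = trans (⋆-comm g 𝟙 n) (⋆-identityˡ g n)

  ·𝟙-⋆ : ∀ x f → x · 𝟙 ⋆ f ≋ x · f
  ·𝟙-⋆ x f n = trans (·-⋆ x 𝟙 f n) (*-congˡ (⋆-identityˡ f n))

  powerSeriesRing : CommutativeRing c ℓ
  powerSeriesRing = record
    { isCommutativeRing = record
      { isRing = record
        { +-isAbelianGroup = Pointwise.isAbelianGroup ℕ +-isAbelianGroup
        ; *-cong           = ⋆-cong
        ; *-assoc          = ⋆-assoc
        ; *-identity       = ⋆-identityˡ , ⋆-identityʳ
        ; distrib          = (λ h f g → ⋆-distribˡ f g h) , (λ h f g → ⋆-distribʳ f g h)
        }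
      ; *-comm = ⋆-comm
      }
    }

  open RingSums powerSeriesRing public using () renaming (∑ to ∑ₛ; _^_ to _^ₛ_; ^-cong to ^ₛ-cong)

  ∑ₛ-coeff : ∀ n F a → ∑ₛ n F a ≈ ∑ n (λ m → F m a)
  ∑ₛ-coeff zero    F a = refl
  ∑ₛ-coeff (suc n) F a = +-congʳ (∑ₛ-coeff n F a)

module PowerSeriesReversal {c ℓ} (R : CommutativeRing c ℓ) where
  open CommutativeRing R
  open RingProperties ring using (-0#≈0#)
  open PowerSeries R public
  module S = CommutativeRing powerSeriesRing
  open RingLemmas powerSeriesRing using (x+y≈z+w⇒z-y≈x-w)
  open SetoidReasoning S.setoid

  X^_ : ℕ → Series
  X^ zero  = 𝟙
  X^ suc k = shift (X^ k)

  repunit : ℕ → Series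
  repunit zero    = 𝟘
  repunit (suc n) = 𝟙 ⊕ shift (repunit n)

  reverse : ℕ → Series → Series
  reverse zero    f zero    = f 0
  reverse zero    f (suc i) = 0#
  reverse (suc c) f zero    = f (suc c)
  reverse (suc c) f (suc i) = reverse c f i

  Deg≤ : ℕ → Series → Set ℓ
  Deg≤ c f = ∀ i → c < i → f i ≈ 0#

  shift-cong : ∀ {f g} → f ≋ g → shift f ≋ shift g
  shift-cong f≋g zero    = refl
  shift-cong f≋g (suc i) = f≋g i

  shift-⊕ : ∀ f g → shift (f ⊕ g) ≋ shift f ⊕ shift g
  shift-⊕ f g zero    = sym (+-identityʳ 0#)
  shift-⊕ f g (suc i) = refl

  shift-· : ∀ x f → shift (x · f) ≋ x · shift f
  shift-· x f zero    = sym (zeroʳ x)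
  shift-· x f (suc i) = refl

  shift-⋆ : ∀ f g → shift f ⋆ g ≋ shift (f ⋆ g)
  shift-⋆ f g zero    = zeroˡ _
  shift-⋆ f g (suc n) = trans (⋆-unfold (shift f) g n) (trans (+-congʳ (zeroˡ _)) (+-identityˡ _))

  X^1-⋆ : ∀ f → X^ 1 ⋆ f ≋ shift f
  X^1-⋆ f = S.trans (shift-⋆ 𝟙 f) (shift-cong (⋆-identityˡ f))

  X^1-⋆-·X^ : ∀ x k → X^ 1 ⋆ (x · X^ k) ≋ x · X^ suc k
  X^1-⋆-·X^ x k = S.trans (X^1-⋆ (x · X^ k)) (shift-· x (X^ k))

  split : ∀ f → f ≋ f 0 · 𝟙 ⊕ shift (f ∘ suc)
  split f zero    = sym (trans (+-identityʳ _) (*-identityʳ _))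
  split f (suc i) = sym (trans (+-congʳ (zeroʳ _)) (+-identityˡ _))

  X^-⋆-≤ : ∀ k f i → k ≤ i → (X^ k ⋆ f) i ≈ f (i ∸ k)
  X^-⋆-≤ zero    f i       _         = ⋆-identityˡ f i
  X^-⋆-≤ (suc k) f (suc i) (s≤s k≤i) = trans (shift-⋆ (X^ k) f (suc i)) (X^-⋆-≤ k f i k≤i)

  X^-⋆-< : ∀ k f i → i < k → (X^ k ⋆ f) i ≈ 0#
  X^-⋆-< (suc k) f zero    _         = shift-⋆ (X^ k) f 0
  X^-⋆-< (suc k) f (suc i) (s≤s i<k) = trans (shift-⋆ (X^ k) f (suc i)) (X^-⋆-< k f i i<k)

  repunit-suc : ∀ n → 𝟙 ⊕ shift (repunit n) ≋ repunit n ⊕ X^ n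
  repunit-suc zero    = λ { zero → +-comm 1# 0# ; (suc i) → refl }
  repunit-suc (suc n) = begin
    𝟙 ⊕ shift (𝟙 ⊕ shift (repunit n))   ≈⟨ S.+-congˡ (shift-cong (repunit-suc n)) ⟩
    𝟙 ⊕ shift (repunit n ⊕ X^ n)        ≈⟨ S.+-congˡ (shift-⊕ (repunit n) (X^ n)) ⟩
    𝟙 ⊕ (shift (repunit n) ⊕ X^ suc n)  ≈⟨ S.+-assoc _ _ _ ⟨
    repunit (suc n) ⊕ X^ suc n          ∎

  repunit-telescope : ∀ n → repunit n ⊕ ⊝ shift (repunit n) ≋ 𝟙 ⊕ ⊝ X^ n
  repunit-telescope n = x+y≈z+w⇒z-y≈x-w (repunit-suc n)

  ·-telescope : ∀ x {v w} → v ⊕ ⊝ shift v ≋ w → x · v ⊕ ⊝ (X^ 1 ⋆ (x · v)) ≋ x · w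
  ·-telescope x {v} {w} v-shift-v≋w = begin
    x · v ⊕ ⊝ (X^ 1 ⋆ (x · v))   ≈⟨ S.+-congˡ (S.-‿cong (S.trans (X^1-⋆ (x · v)) (shift-· x v))) ⟩
    x · v ⊕ ⊝ (x · shift v)      ≈⟨ S.+-congˡ (·-distrib-⊝ x (shift v)) ⟨
    x · v ⊕ x · (⊝ shift v)      ≈⟨ ·-distrib-⊕ x v (⊝ shift v) ⟨
    x · (v ⊕ ⊝ shift v)          ≈⟨ ·-congʳ x v-shift-v≋w ⟩
    x · w                        ∎

  reverse-≤ : ∀ c f i → i ≤ c → reverse c f i ≡ f (c ∸ i)
  reverse-≤ zero    f zero    _         = ≡.refl
  reverse-≤ (suc c) f zero    _         = ≡.refl
  reverse-≤ (suc c) f (suc i) (s≤s i≤c) = reverse-≤ c f i i≤c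

  reverse-cong : ∀ c {f g} → f ≋ g → reverse c f ≋ reverse c g
  reverse-cong zero    f≋g zero    = f≋g 0
  reverse-cong zero    f≋g (suc i) = refl
  reverse-cong (suc c) f≋g zero    = f≋g (suc c)
  reverse-cong (suc c) f≋g (suc i) = reverse-cong c f≋g i

  reverse-⊕ : ∀ c f g → reverse c (f ⊕ g) ≋ reverse c f ⊕ reverse c g
  reverse-⊕ zero    f g zero    = refl
  reverse-⊕ zero    f g (suc i) = sym (+-identityʳ 0#)
  reverse-⊕ (suc c) f g zero    = refl
  reverse-⊕ (suc c) f g (suc i) = reverse-⊕ c f g i

  reverse-⊝ : ∀ c f → reverse c (⊝ f) ≋ ⊝ reverse c f
  reverse-⊝ zero    f zero    = refl
  reverse-⊝ zero    f (suc i) = sym -0#≈0#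
  reverse-⊝ (suc c) f zero    = refl
  reverse-⊝ (suc c) f (suc i) = reverse-⊝ c f i

  reverse-· : ∀ c x f → reverse c (x · f) ≋ x · reverse c f
  reverse-· zero    x f zero    = refl
  reverse-· zero    x f (suc i) = sym (zeroʳ x)
  reverse-· (suc c) x f zero    = refl
  reverse-· (suc c) x f (suc i) = reverse-· c x f i

  reverse-shift : ∀ c f → reverse (suc c) (shift f) ≋ reverse c f
  reverse-shift zero    f zero          = refl
  reverse-shift zero    f (suc zero)    = refl
  reverse-shift zero    f (suc (suc i)) = refl
  reverse-shift (suc c) f zero          = refl
  reverse-shift (suc c) f (suc i)       = reverse-shift c f i

  reverse-X^ : ∀ c k → k ≤ c → reverse c (X^ k) ≋ X^ (c ∸ k)
  reverse-X^ zero    zero    _         zero    = refl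
  reverse-X^ zero    zero    _         (suc i) = refl
  reverse-X^ (suc c) zero    _         zero    = refl
  reverse-X^ (suc c) zero    _         (suc i) = reverse-X^ c 0 z≤n i
  reverse-X^ (suc c) (suc k) (s≤s k≤c) i       = trans (reverse-shift c (X^ k) i) (reverse-X^ c k k≤c i)

  reverse-repunit : ∀ n → reverse n (repunit n) ≋ shift (repunit n)
  reverse-repunit zero    = λ { zero → refl ; (suc i) → refl }
  reverse-repunit (suc n) = begin
    reverse (suc n) (𝟙 ⊕ shift (repunit n))                  ≈⟨ reverse-⊕ (suc n) 𝟙 _ ⟩
    reverse (suc n) 𝟙 ⊕ reverse (suc n) (shift (repunit n))  ≈⟨ S.+-cong (reverse-X^ (suc n) 0 z≤n) (reverse-shift n (repunit n)) ⟩
    X^ suc n ⊕ reverse n (repunit n)                         ≈⟨ S.+-congˡ (reverse-repunit n) ⟩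
    X^ suc n ⊕ shift (repunit n)                             ≈⟨ S.+-comm _ _ ⟩
    shift (repunit n) ⊕ X^ suc n                             ≈⟨ shift-⊕ (repunit n) (X^ n) ⟨
    shift (repunit n ⊕ X^ n)                                 ≈⟨ shift-cong (repunit-suc n) ⟨
    shift (𝟙 ⊕ shift (repunit n))                            ∎

  reverse-𝟙⊝repunit : ∀ n → reverse n (𝟙 ⊕ ⊝ repunit n) ≋ 𝟙 ⊕ ⊝ repunit n
  reverse-𝟙⊝repunit n = begin
    reverse n (𝟙 ⊕ ⊝ repunit n)               ≈⟨ reverse-⊕ n 𝟙 _ ⟩
    reverse n 𝟙 ⊕ reverse n (⊝ repunit n)
      ≈⟨ S.+-cong (reverse-X^ n 0 z≤n) (S.trans (reverse-⊝ n _) (S.-‿cong (reverse-repunit n))) ⟩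
    X^ n ⊕ ⊝ shift (repunit n)                ≈⟨ x+y≈z+w⇒z-y≈x-w (S.trans (repunit-suc n) (S.+-comm _ _)) ⟩
    𝟙 ⊕ ⊝ repunit n                           ∎

  X^-off : ∀ k i → i ≢ k → (X^ k) i ≈ 0#
  X^-off zero    zero    0≢0   = contradiction ≡.refl 0≢0
  X^-off zero    (suc i) _     = refl
  X^-off (suc k) zero    _     = refl
  X^-off (suc k) (suc i) i+1≢k+1 = X^-off k i (i+1≢k+1 ∘ ≡.cong suc)

  Deg≤-mono : ∀ {a b f} → a ≤ b → Deg≤ a f → Deg≤ b f
  Deg≤-mono a≤b deg i b<i = deg i (ℕₚ.≤-<-trans a≤b b<i)

  Deg≤-𝟙 : Deg≤ 0 𝟙
  Deg≤-𝟙 (suc i) _ = refl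

  Deg≤-shift : ∀ {c f} → Deg≤ c f → Deg≤ (suc c) (shift f)
  Deg≤-shift deg (suc i) (s≤s c<i) = deg i c<i

  Deg≤-⊕ : ∀ {c f g} → Deg≤ c f → Deg≤ c g → Deg≤ c (f ⊕ g)
  Deg≤-⊕ degf degg i c<i = trans (+-cong (degf i c<i) (degg i c<i)) (+-identityʳ 0#)

  Deg≤-⊝ : ∀ {c f} → Deg≤ c f → Deg≤ c (⊝ f)
  Deg≤-⊝ deg i c<i = trans (-‿cong (deg i c<i)) -0#≈0#

  Deg≤-· : ∀ {c} x {f} → Deg≤ c f → Deg≤ c (x · f)
  Deg≤-· x deg i c<i = trans (*-congˡ (deg i c<i)) (zeroʳ x)

  Deg≤-repunit : ∀ n → Deg≤ n (repunit n)
  Deg≤-repunit zero    i _ = refl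
  Deg≤-repunit (suc n) = Deg≤-⊕ (Deg≤-mono z≤n Deg≤-𝟙) (Deg≤-shift (Deg≤-repunit n))

  Deg≤-⋆ : ∀ {a b f g} → Deg≤ a f → Deg≤ b g → Deg≤ (a ℕ.+ b) (f ⋆ g)
  Deg≤-⋆ {a} {b} {f} {g} degf degg i a+b<i = ∑-zero i term≈0
    where
    term≈0 : ∀ j → j ≤ i → f j * g (i ∸ j) ≈ 0#
    term≈0 j j≤i with j ℕ.≤? a
    ... | no j≰a  = trans (*-congʳ (degf j (ℕₚ.≰⇒> j≰a))) (zeroˡ _)
    ... | yes j≤a = trans (*-congˡ (degg (i ∸ j) (≤∧+<⇒<∸ j≤a a+b<i))) (zeroʳ _)

  reverse-suc : ∀ c {f} → Deg≤ c f → reverse (suc c) f ≋ shift (reverse c f)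
  reverse-suc c deg zero    = deg (suc c) ℕₚ.≤-refl
  reverse-suc c deg (suc i) = refl

  reverse-zero : ∀ {f} → Deg≤ 0 f → reverse 0 f ≋ f
  reverse-zero deg zero    = refl
  reverse-zero deg (suc i) = sym (deg (suc i) (s≤s z≤n))

  reverse-+ : ∀ k b {g} → Deg≤ b g → reverse (k ℕ.+ b) g ≋ X^ k ⋆ reverse b g
  reverse-+ zero    b deg = S.sym (⋆-identityˡ _)
  reverse-+ (suc k) b {g} deg = begin
    reverse (suc k ℕ.+ b) g          ≈⟨ reverse-suc (k ℕ.+ b) (Deg≤-mono (ℕₚ.m≤n+m b k) deg) ⟩
    shift (reverse (k ℕ.+ b) g)      ≈⟨ shift-cong (reverse-+ k b deg) ⟩
    shift (X^ k ⋆ reverse b g)       ≈⟨ shift-⋆ (X^ k) (reverse b g) ⟨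
    X^ suc k ⋆ reverse b g           ∎

  reverse-⋆ : ∀ a b {f g} → Deg≤ a f → Deg≤ b g → reverse (a ℕ.+ b) (f ⋆ g) ≋ reverse a f ⋆ reverse b g
  reverse-⋆ zero b {f} {g} degf degg = begin
    reverse b (f ⋆ g)               ≈⟨ reverse-cong b (⋆-congʳ g f≋f₀) ⟩
    reverse b (f 0 · 𝟙 ⋆ g)         ≈⟨ reverse-cong b (·𝟙-⋆ (f 0) g) ⟩
    reverse b (f 0 · g)             ≈⟨ reverse-· b (f 0) g ⟩
    f 0 · reverse b g               ≈⟨ ·𝟙-⋆ (f 0) (reverse b g) ⟨
    f 0 · 𝟙 ⋆ reverse b g           ≈⟨ ⋆-congʳ (reverse b g) (S.trans (S.sym f≋f₀) (S.sym (reverse-zero degf))) ⟩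
    reverse 0 f ⋆ reverse b g       ∎
    where
    f≋f₀ : f ≋ f 0 · 𝟙
    f≋f₀ zero    = sym (*-identityʳ _)
    f≋f₀ (suc i) = trans (degf (suc i) (s≤s z≤n)) (sym (zeroʳ _))
  reverse-⋆ (suc a) b {f} {g} degf degg = begin
    reverse (suc a ℕ.+ b) (f ⋆ g)
      ≈⟨ reverse-cong (suc a ℕ.+ b) (S.trans (⋆-congʳ g (split f)) (⋆-distribʳ _ _ g)) ⟩
    reverse (suc a ℕ.+ b) (f 0 · 𝟙 ⋆ g ⊕ shift f′ ⋆ g)
      ≈⟨ reverse-cong (suc a ℕ.+ b) (S.+-cong (·𝟙-⋆ (f 0) g) (shift-⋆ f′ g)) ⟩
    reverse (suc a ℕ.+ b) (f 0 · g ⊕ shift (f′ ⋆ g))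
      ≈⟨ reverse-⊕ (suc a ℕ.+ b) _ _ ⟩
    reverse (suc a ℕ.+ b) (f 0 · g) ⊕ reverse (suc a ℕ.+ b) (shift (f′ ⋆ g))
      ≈⟨ S.+-cong (reverse-· (suc a ℕ.+ b) (f 0) g) (reverse-shift (a ℕ.+ b) (f′ ⋆ g)) ⟩
    f 0 · reverse (suc a ℕ.+ b) g ⊕ reverse (a ℕ.+ b) (f′ ⋆ g)
      ≈⟨ S.+-cong (λ i → *-congˡ (reverse-+ (suc a) b degg i)) (reverse-⋆ a b degf′ degg) ⟩
    f 0 · (X^ suc a ⋆ reverse b g) ⊕ reverse a f′ ⋆ reverse b g
      ≈⟨ S.+-congʳ (·-⋆ (f 0) (X^ suc a) (reverse b g)) ⟨
    f 0 · X^ suc a ⋆ reverse b g ⊕ reverse a f′ ⋆ reverse b g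
      ≈⟨ ⋆-distribʳ _ _ (reverse b g) ⟨
    (f 0 · X^ suc a ⊕ reverse a f′) ⋆ reverse b g
      ≈⟨ ⋆-congʳ (reverse b g) reverse-split ⟨
    reverse (suc a) f ⋆ reverse b g ∎
    where
    f′ = f ∘ suc
    degf′ : Deg≤ a f′
    degf′ i a<i = degf (suc i) (s≤s a<i)
    reverse-split : reverse (suc a) f ≋ f 0 · X^ suc a ⊕ reverse a f′
    reverse-split = begin
      reverse (suc a) f                                        ≈⟨ reverse-cong (suc a) (split f) ⟩
      reverse (suc a) (f 0 · 𝟙 ⊕ shift f′)                     ≈⟨ reverse-⊕ (suc a) _ _ ⟩
      reverse (suc a) (f 0 · 𝟙) ⊕ reverse (suc a) (shift f′)   ≈⟨ S.+-cong (reverse-· (suc a) (f 0) 𝟙) (reverse-shift a f′) ⟩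
      f 0 · reverse (suc a) 𝟙 ⊕ reverse a f′                   ≈⟨ S.+-congʳ (λ i → *-congˡ (reverse-X^ (suc a) 0 z≤n i)) ⟩
      f 0 · X^ suc a ⊕ reverse a f′                            ∎

  reverse-∑ₛ : ∀ c n F → reverse c (∑ₛ n F) ≋ ∑ₛ n (λ m → reverse c (F m))
  reverse-∑ₛ c zero    F = S.refl
  reverse-∑ₛ c (suc n) F = S.trans (reverse-⊕ c _ _) (S.+-congʳ (reverse-∑ₛ c n F))

  Deg≤-∑ₛ : ∀ {d} n {F} → (∀ m → m ≤ n → Deg≤ d (F m)) → Deg≤ d (∑ₛ n F)
  Deg≤-∑ₛ zero    deg = deg 0 z≤n
  Deg≤-∑ₛ (suc n) deg = Deg≤-⊕ (Deg≤-∑ₛ n (λ m m≤n → deg m (ℕₚ.m≤n⇒m≤1+n m≤n))) (deg (suc n) ℕₚ.≤-refl)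

module BivariateReversal {c ℓ} (R : CommutativeRing c ℓ) where
  module T = PowerSeriesReversal R
  module Z = PowerSeries T.powerSeriesRing
  open T using (Deg≤; reverse)
  open Z using (Series; _≋_; _⊕_; ⊝_; _⋆_; _^ₛ_)

  Deg≤ₜ : ℕ → Series → Set ℓ
  Deg≤ₜ k F = ∀ n → Deg≤ (k ℕ.+ n) (F n)

  -- ρ k F = t^k F(tz, 1/t)
  ρ : ℕ → Series → Series
  ρ k F n = reverse (k ℕ.+ n) (F n)

  ρ-cong : ∀ k {F G} → F ≋ G → ρ k F ≋ ρ k G
  ρ-cong k F≋G n = T.reverse-cong (k ℕ.+ n) (F≋G n)

  Deg≤ₜ-𝟙 : Deg≤ₜ 0 Z.𝟙
  Deg≤ₜ-𝟙 zero    = T.Deg≤-𝟙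
  Deg≤ₜ-𝟙 (suc n) i _ = CommutativeRing.refl R

  Deg≤ₜ-⊕ : ∀ {k F G} → Deg≤ₜ k F → Deg≤ₜ k G → Deg≤ₜ k (F ⊕ G)
  Deg≤ₜ-⊕ degF degG n = T.Deg≤-⊕ (degF n) (degG n)

  Deg≤ₜ-⊝ : ∀ {k F} → Deg≤ₜ k F → Deg≤ₜ k (⊝ F)
  Deg≤ₜ-⊝ deg n = T.Deg≤-⊝ (deg n)

  private
    split-index : ∀ {m n} k l → m ≤ n → (k ℕ.+ l) ℕ.+ n ≡ (k ℕ.+ m) ℕ.+ (l ℕ.+ (n ∸ m))
    split-index {m} {n} k l m≤n = ≡.trans (≡.cong ((k ℕ.+ l) ℕ.+_) (≡.sym (ℕₚ.m+[n∸m]≡n m≤n)))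
      (CommutativeSemigroupProperties.interchange ℕₚ.+-commutativeSemigroup k l m (n ∸ m))

  Deg≤ₜ-⋆ : ∀ {k l F G} → Deg≤ₜ k F → Deg≤ₜ l G → Deg≤ₜ (k ℕ.+ l) (F ⋆ G)
  Deg≤ₜ-⋆ {k} {l} {F} {G} degF degG n = T.Deg≤-∑ₛ n (λ m m≤n →
    ≡.subst (λ d → Deg≤ d (F m T.⋆ G (n ∸ m))) (≡.sym (split-index k l m≤n)) (T.Deg≤-⋆ (degF m) (degG (n ∸ m))))

  Deg≤ₜ-^ₛ : ∀ {F} m → Deg≤ₜ 0 F → Deg≤ₜ 0 (F ^ₛ m)
  Deg≤ₜ-^ₛ zero    deg = Deg≤ₜ-𝟙
  Deg≤ₜ-^ₛ (suc m) deg = Deg≤ₜ-⋆ (Deg≤ₜ-^ₛ m deg) deg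

  ρ-⋆ : ∀ k l {F G} → Deg≤ₜ k F → Deg≤ₜ l G → ρ (k ℕ.+ l) (F ⋆ G) ≋ ρ k F ⋆ ρ l G
  ρ-⋆ k l {F} {G} degF degG n = T.S.trans (T.reverse-∑ₛ ((k ℕ.+ l) ℕ.+ n) n _) (Z.∑-cong≤ n (λ m m≤n →
    T.S.trans (T.S.reflexive (≡.cong (λ d → reverse d (F m T.⋆ G (n ∸ m))) (split-index k l m≤n)))
              (T.reverse-⋆ (k ℕ.+ m) (l ℕ.+ (n ∸ m)) (degF m) (degG (n ∸ m)))))

record Filtration {c ℓ} (R : CommutativeRing c ℓ) p : Set (c ⊔ ℓ ⊔ lsuc p) where
  open CommutativeRing R
  infix 4 _∈F_
  field
    _∈F_        : Carrier → ℕ → Set p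
    ∈F-resp     : ∀ {m x y} → x ≈ y → x ∈F m → y ∈F m
    ∈F-antitone : ∀ {m k x} → k ≤ m → x ∈F m → x ∈F k
    ∈F-0        : ∀ x → x ∈F 0
    ∈F-+        : ∀ {m x y} → x ∈F m → y ∈F m → x + y ∈F m
    ∈F-neg      : ∀ {m x} → x ∈F m → - x ∈F m
    ∈F-*        : ∀ {m k x y} → x ∈F m → y ∈F k → x * y ∈F (m ℕ.+ k)

  Separated : Set (c ⊔ ℓ ⊔ p)
  Separated = ∀ x → (∀ m → x ∈F m) → x ≈ 0#

module Filtered {c ℓ p} {R : CommutativeRing c ℓ} (F : Filtration R p) where
  open CommutativeRing R
  open RingProperties ring using (-‿distribˡ-*; -‿anti-homo-+; -‿involutive; x∙y⁻¹≈ε⇒x≈y; xyx⁻¹≈y)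
  open Filtration F
  open RingSums R
  open SetoidReasoning setoid

  ∈F-∑ : ∀ {m} n {f} → (∀ i → i ≤ n → f i ∈F m) → ∑ n f ∈F m
  ∈F-∑ zero    f∈F = f∈F 0 z≤n
  ∈F-∑ (suc n) f∈F = ∈F-+ (∈F-∑ n (λ i i≤n → f∈F i (ℕₚ.m≤n⇒m≤1+n i≤n))) (f∈F (suc n) ℕₚ.≤-refl)

  ∈F-*ˡ : ∀ {m x} y → x ∈F m → x * y ∈F m
  ∈F-*ˡ {m} {x} y x∈F = ≡.subst (x * y ∈F_) (ℕₚ.+-identityʳ m) (∈F-* x∈F (∈F-0 y))

  ∈F-^ : ∀ {h} m → h ∈F 1 → h ^ m ∈F m
  ∈F-^ zero    h∈F = ∈F-0 _
  ∈F-^ {h} (suc m) h∈F = ≡.subst (h ^ suc m ∈F_) (ℕₚ.+-comm m 1) (∈F-* (∈F-^ m h∈F) h∈F)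

  -- J f - 1 = (J - S) f - h^(M+1) for the partial geometric sum S = 1 + h + ... + h^M.
  inverse-of-truncations : Separated → ∀ f J → 1# - f ∈F 1 →
                           (∀ M → J - ∑ M ((1# - f) ^_) ∈F suc M) → J * f ≈ 1#
  inverse-of-truncations separated f J h∈F J≈S = x∙y⁻¹≈ε⇒x≈y _ _ (separated _ J*f-1∈F)
    where
    h = 1# - f
    f≈1-h : f ≈ 1# - h
    f≈1-h = sym (begin
      1# - h               ≈⟨ +-congˡ (-‿anti-homo-+ 1# (- f)) ⟩
      1# + (- - f - 1#)    ≈⟨ +-congˡ (+-congʳ (-‿involutive f)) ⟩
      1# + (f - 1#)        ≈⟨ +-assoc _ _ _ ⟨
      1# + f - 1#          ≈⟨ xyx⁻¹≈y 1# f ⟩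
      f                    ∎)
    J*f-1∈F : ∀ m → J * f - 1# ∈F m
    J*f-1∈F zero    = ∈F-0 _
    J*f-1∈F (suc M) = ∈F-resp eq (∈F-+ (∈F-*ˡ f (J≈S M)) (∈F-neg (∈F-^ (suc M) h∈F)))
      where
      S = ∑ M (h ^_)
      r = h ^ suc M
      eq : (J - S) * f - r ≈ J * f - 1#
      eq = begin
        (J - S) * f - r             ≈⟨ +-congʳ (trans (distribʳ f J (- S)) (+-congˡ (sym (-‿distribˡ-* S f)))) ⟩
        (J * f - S * f) - r         ≈⟨ +-congʳ (+-congˡ (-‿cong (trans (*-congˡ f≈1-h) (geometric-sum M h)))) ⟩
        (J * f - (1# - r)) - r      ≈⟨ +-assoc _ _ _ ⟩
        J * f + (- (1# - r) - r)    ≈⟨ +-congˡ (+-congʳ (-‿anti-homo-+ 1# (- r))) ⟩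
        J * f + ((- - r - 1#) - r)  ≈⟨ +-congˡ (trans (+-congʳ (+-comm _ _)) (+-assoc _ _ _)) ⟩
        J * f + (- 1# + (- - r - r)) ≈⟨ +-congˡ (+-congˡ (-‿inverseˡ (- r))) ⟩
        J * f + (- 1# + 0#)         ≈⟨ +-congˡ (+-identityʳ _) ⟩
        J * f - 1#                  ∎

trivialFiltration : ∀ {c ℓ} (R : CommutativeRing c ℓ) → Filtration R ℓ
trivialFiltration R = record
  { _∈F_        = λ x m → 1 ≤ m → x ≈ 0#
  ; ∈F-resp     = λ x≈y x≈0 1≤m → trans (sym x≈y) (x≈0 1≤m)
  ; ∈F-antitone = λ k≤m x≈0 1≤k → x≈0 (ℕₚ.≤-trans 1≤k k≤m)
  ; ∈F-0        = λ _ ()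
  ; ∈F-+        = λ x≈0 y≈0 1≤m → trans (+-cong (x≈0 1≤m) (y≈0 1≤m)) (+-identityʳ 0#)
  ; ∈F-neg      = λ x≈0 1≤m → trans (-‿cong (x≈0 1≤m)) -0#≈0#
  ; ∈F-*        = ∈F-*
  }
  where
  open CommutativeRing R
  open RingProperties ring using (-0#≈0#)
  ∈F-* : ∀ {m k x y} → (1 ≤ m → x ≈ 0#) → (1 ≤ k → y ≈ 0#) → 1 ≤ m ℕ.+ k → x * y ≈ 0#
  ∈F-* {zero}  y≈0 x≈0 1≤k = trans (*-congˡ (x≈0 1≤k)) (zeroʳ _)
  ∈F-* {suc m} x≈0 y≈0 _   = trans (*-congʳ (x≈0 (s≤s z≤n))) (zeroˡ _)

trivialFiltration-separated : ∀ {c ℓ} (R : CommutativeRing c ℓ) → Filtration.Separated (trivialFiltration R)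
trivialFiltration-separated R x x∈F = x∈F 1 ℕₚ.≤-refl

module _ {c ℓ p} {R : CommutativeRing c ℓ} (F : Filtration R p) where
  open CommutativeRing R
  open PowerSeries R
  open Filtration F
  open Filtered F using (∈F-∑)

  -- Iterated from the trivial filtration, this is the filtration by total degree.
  powerSeriesFiltration : Filtration powerSeriesRing p
  powerSeriesFiltration = record
    { _∈F_        = λ f m → ∀ n → f n ∈F (m ∸ n)
    ; ∈F-resp     = λ f≋g f∈F n → ∈F-resp (f≋g n) (f∈F n)
    ; ∈F-antitone = λ k≤m f∈F n → ∈F-antitone (ℕₚ.∸-monoˡ-≤ n k≤m) (f∈F n)
    ; ∈F-0        = λ f n → ≡.subst (f n ∈F_) (≡.sym (ℕₚ.0∸n≡0 n)) (∈F-0 (f n))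
    ; ∈F-+        = λ f∈F g∈F n → ∈F-+ (f∈F n) (g∈F n)
    ; ∈F-neg      = λ f∈F n → ∈F-neg (f∈F n)
    ; ∈F-*        = λ f∈F g∈F n → ∈F-∑ n (λ i i≤n → ∈F-antitone (∸-split-≤ i≤n) (∈F-* (f∈F i) (g∈F (n ∸ i))))
    }
    where
    ∸-split-≤ : ∀ {m k i n} → i ≤ n → (m ℕ.+ k) ∸ n ≤ (m ∸ i) ℕ.+ (k ∸ (n ∸ i))
    ∸-split-≤ {m} {k} {i} {n} i≤n = ≡.subst (λ n′ → (m ℕ.+ k) ∸ n′ ≤ (m ∸ i) ℕ.+ (k ∸ (n ∸ i)))
                                            (ℕₚ.m+[n∸m]≡n i≤n) (∸-+-≤ m k i (n ∸ i))

  powerSeriesFiltration-separated : Separated → Filtration.Separated powerSeriesFiltration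
  powerSeriesFiltration-separated separated f f∈F n =
    separated (f n) (λ k → ≡.subst (f n ∈F_) (ℕₚ.m+n∸n≡m k n) (f∈F (k ℕ.+ n) n))

module PowerSeriesInverse {c ℓ} (R : CommutativeRing c ℓ) where
  open CommutativeRing R
  open RingProperties ring using (x≈y⇒x∙y⁻¹≈ε)
  open PowerSeries R
  open SetoidReasoning setoid
  private
    F : Filtration powerSeriesRing ℓ
    F = powerSeriesFiltration (trivialFiltration R)
  open Filtration F
  open Filtered F

  inverse : Series → Series
  inverse f n = ∑ n (λ m → ((𝟙 ⊕ ⊝ f) ^ₛ m) n)

  inverse-⋆ : ∀ f → f 0 ≈ 1# → inverse f ⋆ f ≋ 𝟙
  inverse-⋆ f f₀≈1 = inverse-of-truncations separated f (inverse f) h∈F₁ truncation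
    where
    separated : Separated
    separated = powerSeriesFiltration-separated (trivialFiltration R) (trivialFiltration-separated R)
    h = 𝟙 ⊕ ⊝ f
    h∈F₁ : h ∈F 1
    h∈F₁ zero    _   = trans (+-congˡ (-‿cong f₀≈1)) (-‿inverseʳ 1#)
    h∈F₁ (suc n) 0<1∸n with s≤s () ← 0<m∸n⇒n<m {1} {suc n} 0<1∸n
    truncation : ∀ M → inverse f ⊕ ⊝ ∑ₛ M (h ^ₛ_) ∈F suc M
    truncation M n 0<1+M∸n = x≈y⇒x∙y⁻¹≈ε (begin
      ∑ n (λ m → (h ^ₛ m) n)
        ≈⟨ ∑-truncate {n} M (ℕₚ.≤-pred (0<m∸n⇒n<m 0<1+M∸n)) (λ m n<m _ → ∈F-^ m h∈F₁ n (ℕₚ.m<n⇒0<n∸m n<m)) ⟨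
      ∑ M (λ m → (h ^ₛ m) n)   ≈⟨ ∑ₛ-coeff M _ n ⟨
      ∑ₛ M (h ^ₛ_) n           ∎)

module TrivariateInverse {c ℓ} (R : CommutativeRing c ℓ) where
  open CommutativeRing R
  open RingProperties ring using (x≈y⇒x∙y⁻¹≈ε)
  open SetoidReasoning setoid
  module S₁ = PowerSeries R
  module S₂ = PowerSeries S₁.powerSeriesRing
  module S₃ = PowerSeries S₂.powerSeriesRing
  open S₃ using (Series; 𝟙; _⊕_; ⊝_; _⋆_; _≋_; _^ₛ_; ∑ₛ)
  private
    F₁ : Filtration R ℓ
    F₁ = trivialFiltration R
    F₂ : Filtration S₁.powerSeriesRing ℓ
    F₂ = powerSeriesFiltration F₁
    F₃ : Filtration S₂.powerSeriesRing ℓ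
    F₃ = powerSeriesFiltration F₂
    F  : Filtration S₃.powerSeriesRing ℓ
    F  = powerSeriesFiltration F₃
  open Filtration F
  open Filtered F

  inverse₃ : Series → Series
  inverse₃ f a b c = S₁.∑ (a ℕ.+ b ℕ.+ c) (λ m → ((𝟙 ⊕ ⊝ f) ^ₛ m) a b c)

  inverse₃-⋆ : ∀ f → f 0 0 0 ≈ 1# → inverse₃ f ⋆ f ≋ 𝟙
  inverse₃-⋆ f f₀≈1 = inverse-of-truncations separated f (inverse₃ f) h∈F₁ truncation
    where
    separated : Separated
    separated = powerSeriesFiltration-separated F₃ (powerSeriesFiltration-separated F₂
                  (powerSeriesFiltration-separated F₁ (trivialFiltration-separated R)))
    below : ∀ {m} a b c → 0 < ((m ∸ a) ∸ b) ∸ c → a ℕ.+ b ℕ.+ c < m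
    below {m} a b c 0<m∸a∸b∸c = 0<m∸n⇒n<m (≡.subst (0 <_) (∸-∸-∸ m a b c) 0<m∸a∸b∸c)
    h = 𝟙 ⊕ ⊝ f
    h∈F₁ : h ∈F 1
    h∈F₁ zero zero zero _ = trans (+-congˡ (-‿cong f₀≈1)) (-‿inverseʳ 1#)
    h∈F₁ (suc a) b c 0<1∸a∸b∸c with s≤s () ← below {1} (suc a) b c 0<1∸a∸b∸c
    h∈F₁ zero (suc b) c 0<1∸a∸b∸c with s≤s () ← below {1} 0 (suc b) c 0<1∸a∸b∸c
    h∈F₁ zero zero (suc c) 0<1∸a∸b∸c with s≤s () ← below {1} 0 0 (suc c) 0<1∸a∸b∸c
    truncation : ∀ M → inverse₃ f ⊕ ⊝ ∑ₛ M (h ^ₛ_) ∈F suc M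
    truncation M a b c 0<1+M∸a∸b∸c = x≈y⇒x∙y⁻¹≈ε (begin
      S₁.∑ d (λ m → (h ^ₛ m) a b c)   ≈⟨ S₁.∑-truncate {d} M (ℕₚ.≤-pred (below a b c 0<1+M∸a∸b∸c)) vanish ⟨
      S₁.∑ M (λ m → (h ^ₛ m) a b c)   ≈⟨ S₁.∑ₛ-coeff M _ c ⟨
      S₁.∑ₛ M (λ m → (h ^ₛ m) a b) c  ≈⟨ S₂.∑ₛ-coeff M _ b c ⟨
      S₂.∑ₛ M (λ m → (h ^ₛ m) a) b c  ≈⟨ S₃.∑ₛ-coeff M _ a b c ⟨
      ∑ₛ M (h ^ₛ_) a b c              ∎)
      where
      d = a ℕ.+ b ℕ.+ c
      vanish : ∀ m → d < m → m ≤ M → (h ^ₛ m) a b c ≈ 0#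
      vanish m d<m _ = ∈F-^ m h∈F₁ a b c (≡.subst (0 <_) (≡.sym (∸-∸-∸ m a b c)) (ℕₚ.m<n⇒0<n∸m d<m))

-- e = e(z), eₜ = e(tz), u = 1 − t, num = u num₁, den = u den₁ and G = num/den = num₁/den₁.
module EulerianGeneratingFunction {c ℓ} (R : CommutativeRing c ℓ) (E : ℕ → CommutativeRing.Carrier R)
                                  (E₀≈1 : CommutativeRing._≈_ R (E 0) (CommutativeRing.1# R)) where
  open CommutativeRing R
  open RingProperties ring using (-0#≈0#; x∙y⁻¹≈ε⇒x≈y)
  open RingSums R using (∑; ∑-cong; ∑-cong≤)
  open BivariateReversal R
  open PowerSeriesInverse T.powerSeriesRing using (inverse; inverse-⋆)
  module Zᴿ = CommutativeRing Z.powerSeriesRing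
  open RingProperties Zᴿ.ring using (-‿distribˡ-*; -‿distribʳ-*)
  open RingLemmas Z.powerSeriesRing using ([x-y]-[x-z]≈z-y; *-cancelʳ-invertible)
  open CommutativeSemigroupProperties Zᴿ.*-commutativeSemigroup using (x∙yz≈y∙xz)

  t : T.Series
  t = T.X^ 1

  e : Z.Series
  e n = E n T.· T.𝟙

  eₜ : Z.Series
  eₜ n = E n T.· T.X^ n

  num : Z.Series
  num = e Z.⊕ Z.⊝ eₜ

  den : Z.Series
  den = eₜ Z.⊕ Z.⊝ (t Z.· e)

  num₁ : Z.Series
  num₁ n = E n T.· T.repunit n

  den₁ : Z.Series
  den₁ n = E n T.· (T.𝟙 T.⊕ T.⊝ T.repunit n)

  G : Z.Series
  G = num₁ Z.⋆ inverse den₁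

  u : Z.Series
  u = Z.𝟙 Z.⊕ Z.⊝ (t Z.· Z.𝟙)

  den₁-constant : den₁ 0 T.≋ T.𝟙
  den₁-constant = T.S.trans (T.·-congʳ (E 0) (λ i → trans (+-congˡ -0#≈0#) (+-identityʳ _)))
                            (λ { zero → trans (*-identityʳ _) E₀≈1 ; (suc i) → zeroʳ _ })

  G⋆den₁≋num₁ : G Z.⋆ den₁ Z.≋ num₁
  G⋆den₁≋num₁ = begin
    (num₁ Z.⋆ inverse den₁) Z.⋆ den₁   ≈⟨ Z.⋆-assoc num₁ _ den₁ ⟩
    num₁ Z.⋆ (inverse den₁ Z.⋆ den₁)   ≈⟨ Z.⋆-congˡ num₁ (inverse-⋆ den₁ den₁-constant) ⟩
    num₁ Z.⋆ Z.𝟙                       ≈⟨ Z.⋆-identityʳ num₁ ⟩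
    num₁                               ∎
    where open SetoidReasoning Zᴿ.setoid

  u-⋆ : ∀ F → u Z.⋆ F Z.≋ F Z.⊕ Z.⊝ (t Z.· F)
  u-⋆ F = begin
    (Z.𝟙 Z.⊕ Z.⊝ (t Z.· Z.𝟙)) Z.⋆ F          ≈⟨ Z.⋆-distribʳ _ _ F ⟩
    Z.𝟙 Z.⋆ F Z.⊕ (Z.⊝ (t Z.· Z.𝟙)) Z.⋆ F    ≈⟨ Zᴿ.+-cong (Z.⋆-identityˡ F) (Zᴿ.sym (-‿distribˡ-* _ F)) ⟩
    F Z.⊕ Z.⊝ ((t Z.· Z.𝟙) Z.⋆ F)            ≈⟨ Zᴿ.+-congˡ (Zᴿ.-‿cong (Z.·𝟙-⋆ t F)) ⟩
    F Z.⊕ Z.⊝ (t Z.· F)                      ∎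
    where open SetoidReasoning Zᴿ.setoid

  u⋆num₁ : u Z.⋆ num₁ Z.≋ num
  u⋆num₁ = Zᴿ.trans (u-⋆ num₁) (λ n → begin
    num₁ n T.⊕ T.⊝ (t T.⋆ num₁ n)          ≈⟨ T.·-telescope (E n) (T.repunit-telescope n) ⟩
    E n T.· (T.𝟙 T.⊕ T.⊝ T.X^ n)           ≈⟨ T.·-distrib-⊕ (E n) _ _ ⟩
    e n T.⊕ E n T.· (T.⊝ T.X^ n)           ≈⟨ T.S.+-congˡ (T.·-distrib-⊝ (E n) _) ⟩
    num n                                  ∎)
    where open SetoidReasoning T.S.setoid

  u⋆den₁ : u Z.⋆ den₁ Z.≋ den
  u⋆den₁ = begin
    u Z.⋆ den₁                              ≈⟨ Z.⋆-congˡ u den₁≋e-num₁ ⟩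
    u Z.⋆ (e Z.⊕ Z.⊝ num₁)                  ≈⟨ Zᴿ.distribˡ u e (Z.⊝ num₁) ⟩
    u Z.⋆ e Z.⊕ u Z.⋆ (Z.⊝ num₁)            ≈⟨ Zᴿ.+-congˡ (-‿distribʳ-* u num₁) ⟨
    u Z.⋆ e Z.⊕ Z.⊝ (u Z.⋆ num₁)            ≈⟨ Zᴿ.+-cong (u-⋆ e) (Zᴿ.-‿cong u⋆num₁) ⟩
    (e Z.⊕ Z.⊝ (t Z.· e)) Z.⊕ Z.⊝ num       ≈⟨ [x-y]-[x-z]≈z-y e (t Z.· e) eₜ ⟩
    den                                     ∎
    where
    open SetoidReasoning Zᴿ.setoid
    den₁≋e-num₁ : den₁ Z.≋ e Z.⊕ Z.⊝ num₁
    den₁≋e-num₁ n = T.S.trans (T.·-distrib-⊕ (E n) _ _) (T.S.+-congˡ (T.·-distrib-⊝ (E n) _))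

  G⋆den≋num : G Z.⋆ den Z.≋ num
  G⋆den≋num = begin
    G Z.⋆ den             ≈⟨ Z.⋆-congˡ G u⋆den₁ ⟨
    G Z.⋆ (u Z.⋆ den₁)    ≈⟨ x∙yz≈y∙xz G u den₁ ⟩
    u Z.⋆ (G Z.⋆ den₁)    ≈⟨ Z.⋆-congˡ u G⋆den₁≋num₁ ⟩
    u Z.⋆ num₁            ≈⟨ u⋆num₁ ⟩
    num                   ∎
    where open SetoidReasoning Zᴿ.setoid

  ⋆den-expand : ∀ F → F Z.⋆ den Z.≋ F Z.⋆ eₜ Z.⊕ Z.⊝ (t Z.· (F Z.⋆ e))
  ⋆den-expand F = begin
    F Z.⋆ (eₜ Z.⊕ Z.⊝ (t Z.· e))         ≈⟨ Zᴿ.distribˡ F eₜ (Z.⊝ (t Z.· e)) ⟩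
    F Z.⋆ eₜ Z.⊕ F Z.⋆ (Z.⊝ (t Z.· e))   ≈⟨ Zᴿ.+-congˡ (-‿distribʳ-* F (t Z.· e)) ⟨
    F Z.⋆ eₜ Z.⊕ Z.⊝ (F Z.⋆ (t Z.· e))   ≈⟨ Zᴿ.+-congˡ (Zᴿ.-‿cong (Z.⋆-· t F e)) ⟩
    F Z.⋆ eₜ Z.⊕ Z.⊝ (t Z.· (F Z.⋆ e))   ∎
    where open SetoidReasoning Zᴿ.setoid

  Deg≤ₜ-inverse : ∀ {f} → Deg≤ₜ 0 f → Deg≤ₜ 0 (inverse f)
  Deg≤ₜ-inverse deg n = T.Deg≤-∑ₛ n (λ m _ → Deg≤ₜ-^ₛ m (Deg≤ₜ-⊕ Deg≤ₜ-𝟙 (Deg≤ₜ-⊝ deg)) n)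

  Deg≤ₜ-den₁ : Deg≤ₜ 0 den₁
  Deg≤ₜ-den₁ n = T.Deg≤-· (E n) (T.Deg≤-⊕ (T.Deg≤-mono z≤n T.Deg≤-𝟙) (T.Deg≤-⊝ (T.Deg≤-repunit n)))

  Deg≤ₜ-G : Deg≤ₜ 0 G
  Deg≤ₜ-G = Deg≤ₜ-⋆ (λ n → T.Deg≤-· (E n) (T.Deg≤-repunit n)) (Deg≤ₜ-inverse Deg≤ₜ-den₁)

  ρ₀-num₁ : ρ 0 num₁ Z.≋ t Z.· num₁
  ρ₀-num₁ n = begin
    T.reverse n (E n T.· T.repunit n)   ≈⟨ T.reverse-· n (E n) _ ⟩
    E n T.· T.reverse n (T.repunit n)   ≈⟨ T.·-congʳ (E n) (T.reverse-repunit n) ⟩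
    E n T.· T.shift (T.repunit n)       ≈⟨ T.shift-· (E n) _ ⟨
    T.shift (num₁ n)                    ≈⟨ T.X^1-⋆ (num₁ n) ⟨
    t T.⋆ num₁ n                        ∎
    where open SetoidReasoning T.S.setoid

  ρ₀-den₁ : ρ 0 den₁ Z.≋ den₁
  ρ₀-den₁ n = T.S.trans (T.reverse-· n (E n) _) (T.·-congʳ (E n) (T.reverse-𝟙⊝repunit n))

  G-palindromic : ρ 0 G Z.≋ t Z.· G
  G-palindromic = *-cancelʳ-invertible {d = den₁} {d⁻¹ = inverse den₁} (inverse-⋆ den₁ den₁-constant) (begin
    ρ 0 G Z.⋆ den₁             ≈⟨ Z.⋆-congˡ (ρ 0 G) ρ₀-den₁ ⟨
    ρ 0 G Z.⋆ ρ 0 den₁         ≈⟨ ρ-⋆ 0 0 Deg≤ₜ-G Deg≤ₜ-den₁ ⟨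
    ρ 0 (G Z.⋆ den₁)           ≈⟨ ρ-cong 0 G⋆den₁≋num₁ ⟩
    ρ 0 num₁                   ≈⟨ ρ₀-num₁ ⟩
    t Z.· num₁                 ≈⟨ Z.·-congʳ t G⋆den₁≋num₁ ⟨
    t Z.· (G Z.⋆ den₁)         ≈⟨ Z.·-⋆ t G den₁ ⟨
    t Z.· G Z.⋆ den₁           ∎)
    where open SetoidReasoning Zᴿ.setoid

  G-diagonal : ∀ m → G m m ≈ 0#
  G-diagonal m = trans (reflexive (≡.sym (T.reverse-≤ m (G m) 0 z≤n))) (trans (G-palindromic m 0) (T.X^1-⋆ (G m) 0))

  G-reflect : ∀ {m b} → b < m → G m (m ∸ suc b) ≈ G m b
  G-reflect {m} {b} b<m = trans (reflexive (≡.sym (T.reverse-≤ m (G m) (suc b) b<m)))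
                                (trans (G-palindromic m (suc b)) (T.X^1-⋆ (G m) (suc b)))

  G-vanishes : ∀ {m b} → m ≤ b → G m b ≈ 0#
  G-vanishes {m} m≤b with ℕₚ.m≤n⇒m<n∨m≡n m≤b
  ... | inj₁ m<b    = Deg≤ₜ-G m _ m<b
  ... | inj₂ ≡.refl = G-diagonal m

  ⋆-·X^-coeff : ∀ F (k : ℕ → ℕ) N i →
                (F Z.⋆ (λ n → E n T.· T.X^ k n)) N i ≈ ∑ N (λ m → E (N ∸ m) * (T.X^ k (N ∸ m) T.⋆ F m) i)
  ⋆-·X^-coeff F k N i = trans (T.∑ₛ-coeff N _ i) (∑-cong N (λ m →
    trans (T.⋆-comm (F m) _ i) (T.·-⋆ (E (N ∸ m)) (T.X^ k (N ∸ m)) (F m) i)))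

  ⋆e-coeff : ∀ F N i → (F Z.⋆ e) N i ≈ ∑ N (λ m → E (N ∸ m) * F m i)
  ⋆e-coeff F N i = trans (⋆-·X^-coeff F (λ _ → 0) N i) (∑-cong N (λ m → *-congˡ (T.⋆-identityˡ (F m) i)))

  G⋆eₜ≈G⋆e : ∀ a b → (G Z.⋆ eₜ) (a ℕ.+ suc b) a ≈ (G Z.⋆ e) (a ℕ.+ suc b) b
  G⋆eₜ≈G⋆e a b = trans (⋆-·X^-coeff G (λ n → n) N a) (trans (∑-cong≤ N term) (sym (⋆e-coeff G N b)))
    where
    N = a ℕ.+ suc b
    term : ∀ m → m ≤ N → E (N ∸ m) * (T.X^ (N ∸ m) T.⋆ G m) a ≈ E (N ∸ m) * G m b
    term m m≤N with m ℕ.≤? b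
    ... | yes m≤b = *-congˡ (trans (T.X^-⋆-< (N ∸ m) (G m) a (<-+-∸ a m≤b)) (sym (G-vanishes m≤b)))
    ... | no  m≰b = *-congˡ (trans (T.X^-⋆-≤ (N ∸ m) (G m) a (+-∸-≤ a b<m m≤N))
                                   (trans (reflexive (≡.cong (G m) (∸-+-∸ a b<m m≤N))) (G-reflect b<m)))
      where b<m = ℕₚ.≰⇒> m≰b

  num-vanishes : ∀ {N i} → 0 < i → i < N → num N i ≈ 0#
  num-vanishes {N} {suc i} _ i<N = begin
    E N * 0# - E N * (T.X^ N) (suc i)   ≈⟨ +-cong (zeroʳ (E N)) (-‿cong (*-congˡ (T.X^-off N (suc i) (ℕₚ.<⇒≢ i<N)))) ⟩
    0# - E N * 0#                      ≈⟨ +-congˡ (-‿cong (zeroʳ (E N))) ⟩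
    0# - 0#                            ≈⟨ -‿inverseʳ 0# ⟩
    0#                                 ∎
    where open SetoidReasoning setoid

  G⋆eₜ≈G⋆e-shifted : ∀ {N i} → suc i < N → (G Z.⋆ eₜ) N (suc i) ≈ (G Z.⋆ e) N i
  G⋆eₜ≈G⋆e-shifted {N} {i} i<N = x∙y⁻¹≈ε⇒x≈y _ _ (begin
    (G Z.⋆ eₜ) N (suc i) - (G Z.⋆ e) N i                ≈⟨ +-congˡ (-‿cong (T.X^1-⋆ ((G Z.⋆ e) N) (suc i))) ⟨
    (G Z.⋆ eₜ) N (suc i) - (t T.⋆ (G Z.⋆ e) N) (suc i)  ≈⟨ ⋆den-expand G N (suc i) ⟨
    (G Z.⋆ den) N (suc i)                               ≈⟨ G⋆den≋num N (suc i) ⟩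
    num N (suc i)                                       ≈⟨ num-vanishes (s≤s z≤n) i<N ⟩
    0#                                                  ∎)
    where open SetoidReasoning setoid

  G⋆e-symmetric : ∀ a b → (G Z.⋆ e) (suc a ℕ.+ suc b) a ≈ (G Z.⋆ e) (suc a ℕ.+ suc b) b
  G⋆e-symmetric a b = trans (sym (G⋆eₜ≈G⋆e-shifted (ℕₚ.m<m+n (suc a) (s≤s z≤n)))) (G⋆eₜ≈G⋆e (suc a) b)

-- Series in q over ℤ, in t over Q and in z over T, so that F n i j is the coefficient of z^n t^i q^j.
module Q = PowerSeries ℤₚ.+-*-commutativeRing
open BivariateReversal Q.powerSeriesRing using (module T; module Z)
open PowerSeriesInverse ℤₚ.+-*-commutativeRing using (inverse; inverse-⋆)
open TrivariateInverse ℤₚ.+-*-commutativeRing using (inverse₃; inverse₃-⋆)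

sumTo≡∑ : ∀ n {f g} → (∀ i → f i ≡ g i) → sumTo n f ≡ Q.∑ n g
sumTo≡∑ zero    f≡g = f≡g 0
sumTo≡∑ (suc n) f≡g = ≡.cong₂ ℤ._+_ (sumTo≡∑ n f≡g) (f≡g (suc n))

mul1≋⋆ : ∀ f g → mul1 f g Q.≋ f Q.⋆ g
mul1≋⋆ f g j = sumTo≡∑ j (λ _ → ≡.refl)

one1≋𝟙 : one1 Q.≋ Q.𝟙
one1≋𝟙 zero    = ≡.refl
one1≋𝟙 (suc j) = ≡.refl

pow1≋^ₛ : ∀ f m → pow1 f m Q.≋ f Q.^ₛ m
pow1≋^ₛ f zero    = one1≋𝟙
pow1≋^ₛ f (suc m) j = ≡.trans (mul1≋⋆ (pow1 f m) f j) (Q.⋆-congʳ f (pow1≋^ₛ f m) j)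

inv1≋inverse : ∀ f → inv1 f Q.≋ inverse f
inv1≋inverse f n = sumTo≡∑ n (λ m → ≡.trans (pow1≋^ₛ _ m n) (Q.^ₛ-cong m (λ j → ≡.cong (ℤ._- f j) (one1≋𝟙 j)) n))

mul3≋⋆ : ∀ f g a b c → mul3 f g a b c ≡ (f Z.⋆ g) a b c
mul3≋⋆ f g a b c = ≡.sym (begin
  (f Z.⋆ g) a b c                                        ≡⟨ T.∑ₛ-coeff a _ b c ⟩
  Q.∑ₛ a (λ n → (f n T.⋆ g (a ∸ n)) b) c                 ≡⟨ Q.∑ₛ-coeff a _ c ⟩
  Q.∑ a (λ n → (f n T.⋆ g (a ∸ n)) b c)                  ≡⟨ Q.∑-cong a (λ n → Q.∑ₛ-coeff b _ c) ⟩
  Q.∑ a (λ n → Q.∑ b (λ i → (f n i Q.⋆ g (a ∸ n) (b ∸ i)) c))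
    ≡⟨ sumTo≡∑ a (λ n → sumTo≡∑ b (λ i → sumTo≡∑ c (λ _ → ≡.refl))) ⟨
  mul3 f g a b c                                         ∎)
  where open ≡.≡-Reasoning

one3≋𝟙 : one3 Z.≋ Z.𝟙
one3≋𝟙 zero    zero    zero    = ≡.refl
one3≋𝟙 zero    zero    (suc j) = ≡.refl
one3≋𝟙 zero    (suc i) j       = ≡.refl
one3≋𝟙 (suc n) i       j       = ≡.refl

pow3≋^ₛ : ∀ f m → pow3 f m Z.≋ f Z.^ₛ m
pow3≋^ₛ f zero    = one3≋𝟙
pow3≋^ₛ f (suc m) n i j = ≡.trans (mul3≋⋆ (pow3 f m) f n i j) (Z.⋆-congʳ f (pow3≋^ₛ f m) n i j)

inv3≋inverse₃ : ∀ f → inv3 f Z.≋ inverse₃ f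
inv3≋inverse₃ f a b c = sumTo≡∑ (a ℕ.+ b ℕ.+ c) (λ m →
  ≡.trans (pow3≋^ₛ _ m a b c) (Z.^ₛ-cong m (λ n i j → ≡.cong (ℤ._- f n i j) (one3≋𝟙 n i j)) a b c))

E : ℕ → Q.Series
E n = inv1 (qq n)

qq-constant : ∀ n → qq n 0 ≡ 1ℤ
qq-constant zero    = ≡.refl
qq-constant (suc n) = ≡.cong (ℤ._* (1ℤ ℤ.- 0ℤ)) (qq-constant n)

E-⋆-qq : ∀ n → E n Q.⋆ qq n Q.≋ Q.𝟙
E-⋆-qq n j = ≡.trans (Q.⋆-congʳ (qq n) (inv1≋inverse (qq n)) j) (inverse-⋆ (qq n) (qq-constant n) j)

if≡ᵇ≋·X^ : ∀ k i x → (λ j → if i ℕ.≡ᵇ k then x j else 0ℤ) Q.≋ (x T.· T.X^ k) i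
if≡ᵇ≋·X^ zero    zero    x j = ≡.sym (Q.⋆-identityʳ x j)
if≡ᵇ≋·X^ zero    (suc i) x j = ≡.sym (Q.⋆-zeroʳ x j)
if≡ᵇ≋·X^ (suc k) zero    x j = ≡.sym (Q.⋆-zeroʳ x j)
if≡ᵇ≋·X^ (suc k) (suc i) x   = if≡ᵇ≋·X^ k i x

E₀≋𝟙 : E 0 Q.≋ Q.𝟙
E₀≋𝟙 j = ≡.trans (≡.sym (Q.⋆-identityʳ (E 0) j)) (≡.trans (Q.⋆-congˡ (E 0) (λ i → ≡.sym (one1≋𝟙 i)) j) (E-⋆-qq 0 j))

module GF = EulerianGeneratingFunction Q.powerSeriesRing E E₀≋𝟙

eZ≋e : eZ Z.≋ GF.e
eZ≋e n i = if≡ᵇ≋·X^ 0 i (E n)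

eTZ≋eₜ : eTZ Z.≋ GF.eₜ
eTZ≋eₜ n i = if≡ᵇ≋·X^ n i (E n)

tEZ≋t·e : tEZ Z.≋ GF.t Z.· GF.e
tEZ≋t·e n i j = ≡.trans (if≡ᵇ≋·X^ 1 i (E n) j) (≡.sym (T.X^1-⋆-·X^ (E n) 0 i j))

genA≋G : genA Z.≋ GF.G
genA≋G = begin
  genA                                ≈⟨ (λ n i j → mul3≋⋆ num (inv3 den) n i j) ⟩
  num Z.⋆ inv3 den                    ≈⟨ Z.⋆-congˡ num (inv3≋inverse₃ den) ⟩
  num Z.⋆ inverse₃ den                ≈⟨ Z.⋆-congʳ (inverse₃ den) G⋆den≋num ⟨
  (GF.G Z.⋆ den) Z.⋆ inverse₃ den     ≈⟨ Z.⋆-assoc GF.G den (inverse₃ den) ⟩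
  GF.G Z.⋆ (den Z.⋆ inverse₃ den)     ≈⟨ Z.⋆-congˡ GF.G (Zᴿ.trans (Z.⋆-comm den (inverse₃ den)) (inverse₃-⋆ den ≡.refl)) ⟩
  GF.G Z.⋆ Z.𝟙                        ≈⟨ Z.⋆-identityʳ GF.G ⟩
  GF.G                                ∎
  where
  module Zᴿ = CommutativeRing Z.powerSeriesRing
  open SetoidReasoning Zᴿ.setoid
  num den : Z.Series
  num = sub3 eZ eTZ
  den = sub3 eTZ tEZ
  G⋆den≋num : GF.G Z.⋆ den Z.≋ num
  G⋆den≋num = Zᴿ.trans (Z.⋆-congˡ GF.G (λ n i j → ≡.cong₂ ℤ._-_ (eTZ≋eₜ n i j) (tEZ≋t·e n i j)))
                (Zᴿ.trans GF.G⋆den≋num (λ n i j → ≡.sym (≡.cong₂ ℤ._-_ (eZ≋e n i j) (eTZ≋eₜ n i j))))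

qbinom≋ : ∀ {N k} → k ≤ N → qbinom N k Q.≋ qq N Q.⋆ (E (N ∸ k) Q.⋆ E k)
qbinom≋ {N} {k} k≤N j with k ℕ.≤ᵇ N | ℕₚ.≤⇒≤ᵇ k≤N
... | true | _ = ≡.trans (mul1≋⋆ (qq N) (mul1 (E (N ∸ k)) (E k)) j) (Q.⋆-congˡ (qq N) (mul1≋⋆ (E (N ∸ k)) (E k)) j)

qEuler≋ : ∀ k c → qEuler k c Q.≋ qq k Q.⋆ GF.G k c
qEuler≋ k c j = ≡.trans (mul1≋⋆ (qq k) (genA k c) j) (Q.⋆-congˡ (qq k) (genA≋G k c) j)

∑-qbinom-qEuler : ∀ N c → (λ j → sumS N (λ k → mul1 (qbinom N k) (qEuler k c)) j) Q.≋ qq N Q.⋆ (GF.G Z.⋆ GF.e) N c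
∑-qbinom-qEuler N c = begin
  (λ j → sumTo N (λ k → F k j))                         ≈⟨ (λ j → sumTo≡∑ N (λ _ → ≡.refl)) ⟩
  (λ j → Q.∑ N (λ k → F k j))                           ≈⟨ Q.∑ₛ-coeff N F ⟨
  T.∑ N F                                               ≈⟨ T.∑-cong≤ N term ⟩
  T.∑ N (λ k → qq N Q.⋆ (E (N ∸ k) Q.⋆ GF.G k c))       ≈⟨ T.*-distribˡ-∑ N (qq N) _ ⟨
  qq N Q.⋆ T.∑ N (λ k → E (N ∸ k) Q.⋆ GF.G k c)         ≈⟨ Q.⋆-congˡ (qq N) (GF.⋆e-coeff GF.G N c) ⟨
  qq N Q.⋆ (GF.G Z.⋆ GF.e) N c                          ∎
  where
  open SetoidReasoning (CommutativeRing.setoid Q.powerSeriesRing)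
  open RingLemmas Q.powerSeriesRing using ([x*[y*z]]*[w*v]≈x*[y*v])
  F = λ k → mul1 (qbinom N k) (qEuler k c)
  term : ∀ k → k ≤ N → F k Q.≋ qq N Q.⋆ (E (N ∸ k) Q.⋆ GF.G k c)
  term k k≤N = begin
    F k                                                  ≈⟨ mul1≋⋆ (qbinom N k) (qEuler k c) ⟩
    qbinom N k Q.⋆ qEuler k c                            ≈⟨ Q.⋆-cong (qbinom≋ k≤N) (qEuler≋ k c) ⟩
    (qq N Q.⋆ (E (N ∸ k) Q.⋆ E k)) Q.⋆ (qq k Q.⋆ GF.G k c)
      ≈⟨ [x*[y*z]]*[w*v]≈x*[y*v] (qq N) (E (N ∸ k)) (E k) (qq k) (GF.G k c) (E-⋆-qq k) ⟩
    qq N Q.⋆ (E (N ∸ k) Q.⋆ GF.G k c)                    ∎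

theorem1 : (a b : ℕ) → 1 ≤ a → 1 ≤ b → (j : ℕ) →
    sumS (a ℕ.+ b) (λ k → mul1 (qbinom (a ℕ.+ b) k) (qEuler k (a ∸ 1))) j
    ≡ sumS (a ℕ.+ b) (λ k → mul1 (qbinom (a ℕ.+ b) k) (qEuler k (b ∸ 1))) j
theorem1 (suc a) (suc b) _ _ j = begin
  sumS N (λ k → mul1 (qbinom N k) (qEuler k a)) j   ≡⟨ ∑-qbinom-qEuler N a j ⟩
  (qq N Q.⋆ (GF.G Z.⋆ GF.e) N a) j                  ≡⟨ Q.⋆-congˡ (qq N) (GF.G⋆e-symmetric a b) j ⟩
  (qq N Q.⋆ (GF.G Z.⋆ GF.e) N b) j                  ≡⟨ ∑-qbinom-qEuler N b j ⟨
  sumS N (λ k → mul1 (qbinom N k) (qEuler k b)) j   ∎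
  where
  N = suc a ℕ.+ suc b
  open ≡.≡-Reasoning
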